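{- Let $n\ge 2$ and let $L$ be a transitive permutation group on $\{1,\ldots,n\}$. Then for every $N_0$ there exists a pair $(\Gamma,G)$, where $\Gamma$ is a finite simple graph with $|V\Gamma|> N_0$ and $G\le\mathrm{Aut}(\Gamma)$, such that: (1) $\Gamma$ is connected, $n$-valent and bipartite with bipartition sets $X$ and $Y$; (2) $(\Gamma,G)$ is a locally-$L$ pair; (3) $V\Gamma$ admits a $G$-invariant partition $\mathcal{P}$ into $2n$ sets $X_1,\ldots,X_n,Y_1,\ldots,Y_n$ such that $\bigcup_{i=1}^n X_i=X$ and $\bigcup_{i=1}^n Y_i=Y$, and every vertex $v\in X$ has precisely one neighbour in each of the sets $Y_i$, $1\le i\le n$; (4) there exists $f\in G$ with $f^2=1$, $X_i^f=Y_i$ and $Y_i^f=X_i$ for all $1\le i\le n$; (5) letting $S$ denote the kernel of the action of $G$ on $\{X,Y\}$: (a) $G=\langle S,f\rangle$ and $S^f=S$; (b) the permutation group $S^{\mathcal{P}}$ induced by $S$ on $\mathcal{P}$ is permutation isomorphic to $L\times L$ in its natural intransitive action on the disjoint union of two copies of $\{1,\ldots,n\}$ (each factor acting on its own copy); (c) for every $v\in X$ and every $\pi\in L$ there exists $s\in S$ such that $v^s=v$, $X_i^s=X_i$ and $Y_i^s=Y_{i^\pi}$ for all $1\le i\le n$.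
   Context: All groups and graphs are finite; graphs are simple. For a graph $\Gamma$, $V\Gamma$ is its vertex set, $\Gamma(v)$ the neighbourhood of $v$, and $\mathrm{Aut}(\Gamma)$ its automorphism group. For $G\le\mathrm{Aut}(\Gamma)$, $G_v$ is the stabiliser of $v$ and $G_v^{\Gamma(v)}$ the permutation group induced by $G_v$ on $\Gamma(v)$. A pair $(\Gamma,G)$ is locally-$L$ if $\Gamma$ is connected, $G$ is transitive on $V\Gamma$, and $G_v^{\Gamma(v)}$ is permutation isomorphic to $L$. Exponents denote images under the action, e.g. $X_i^s$ is the image of $X_i$ under $s$ and $i^\pi$ the image of $i$ under $\pi$. -}

module Defs where

open import Data.Nat using (ℕ; _<_)
open import Data.Fin using (Fin)
open import Data.Bool using (Bool; true; false)
open import Data.Product using (Σ; ∃; ∃-syntax; _×_; _,_; proj₁; proj₂; ∃!)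
open import Data.Sum using (_⊎_; inj₁; inj₂) renaming (map to map⊎)
open import Function using (_∘_; id; _↔_; _⇔_; Inverse)
open import Relation.Binary.PropositionalEquality using (_≡_; _≢_; _≗_)
open import Relation.Binary.Construct.Closure.ReflexiveTransitive using (Star)

record PermGroup (n : ℕ) : Set₁ where
  field
    Mem    : (Fin n → Fin n) → Set
    resp   : ∀ {g h} → g ≗ h → Mem g → Mem h
    id∈    : Mem id
    ∘∈     : ∀ {g h} → Mem g → Mem h → Mem (g ∘ h)
    inv∈   : ∀ {g} → Mem g → ∃[ h ] (Mem h × (h ∘ g ≗ id) × (g ∘ h ≗ id))

open PermGroup public

IsTransitive : ∀ {n} → PermGroup n → Set
IsTransitive {n} L = ∀ (i j : Fin n) → ∃[ σ ] (Mem L σ × σ i ≡ j)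

record Graph : Set where
  field
    N          : ℕ
    adj        : Fin N → Fin N → Bool
    adj-sym    : ∀ u v → adj u v ≡ adj v u
    adj-irrefl : ∀ v → adj v v ≡ false

open Graph public

V : Graph → Set
V Γ = Fin (N Γ)

Edge : (Γ : Graph) → V Γ → V Γ → Set
Edge Γ u v = adj Γ u v ≡ true

Nbr : (Γ : Graph) → V Γ → Set
Nbr Γ v = Σ (V Γ) (Edge Γ v)

Connected : Graph → Set
Connected Γ = ∀ (u v : V Γ) → Star (Edge Γ) u v

Valent : Graph → ℕ → Set
Valent Γ k = ∀ (v : V Γ) → Nbr Γ v ↔ Fin k

IsAutGroup : (Γ : Graph) → PermGroup (N Γ) → Set
IsAutGroup Γ G = ∀ g → Mem G g → ∀ (u v : V Γ) → adj Γ (g u) (g v) ≡ adj Γ u v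

VertexTransitive : ∀ {N} → PermGroup N → Set
VertexTransitive {N} G = ∀ (u v : Fin N) → ∃[ g ] (Mem G g × g u ≡ v)

-- G_v^{Γ(v)} is permutation isomorphic to L: there is a bijection
-- φ : {1..n} → Γ(v) such that the permutations of Γ(v) induced by G_v are
-- exactly the φ-conjugates of the elements of L.
LocalPermIso : ∀ {n} (Γ : Graph) → PermGroup (N Γ) → V Γ → PermGroup n → Set
LocalPermIso {n} Γ G v L =
  Σ (Fin n ↔ Nbr Γ v) λ φ →
    (∀ g → Mem G g → g v ≡ v →
       ∃[ σ ] (Mem L σ × (∀ i → g (proj₁ (Inverse.to φ i)) ≡ proj₁ (Inverse.to φ (σ i)))))
  × (∀ σ → Mem L σ →
       ∃[ g ] (Mem G g × g v ≡ v × (∀ i → g (proj₁ (Inverse.to φ i)) ≡ proj₁ (Inverse.to φ (σ i)))))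

LocallyL : ∀ {n} (Γ : Graph) → PermGroup (N Γ) → PermGroup n → Set
LocallyL Γ G L = Connected Γ × VertexTransitive G × (∀ v → LocalPermIso Γ G v L)

ImageEq : ∀ {N} → (Fin N → Fin N) → (Fin N → Set) → (Fin N → Set) → Set
ImageEq {N} g A B = (∀ v → A v → B (g v)) × (∀ w → B w → ∃[ v ] (A v × g v ≡ w))

data Generated {N : ℕ} (A : (Fin N → Fin N) → Set) : (Fin N → Fin N) → Set where
  gen  : ∀ {g} → A g → Generated A g
  one  : Generated A id
  comp : ∀ {g h} → Generated A g → Generated A h → Generated A (g ∘ h)
  ginv : ∀ {g h} → Generated A g → h ∘ g ≗ id → g ∘ h ≗ id → Generated A h
  gresp : ∀ {g h} → g ≗ h → Generated A g → Generated A h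

-- A bipartition is given by  side : V → Bool,
-- with X = side⁻¹(false) and Y = side⁻¹(true).  The partition 𝒫 is given
-- by  cell : V → Fin n : the part containing v is X_{cell v} if v ∈ X and
-- Y_{cell v} if v ∈ Y.

module _ {n : ℕ} (Γ : Graph) (side : V Γ → Bool) (cell : V Γ → Fin n) where

  InX : V Γ → Set
  InX v = side v ≡ false

  InY : V Γ → Set
  InY v = side v ≡ true

  Xi : Fin n → V Γ → Set
  Xi i v = side v ≡ false × cell v ≡ i

  Yi : Fin n → V Γ → Set
  Yi i v = side v ≡ true × cell v ≡ i

  part : V Γ → Bool × Fin n
  part v = side v , cell v

Bipartite : (Γ : Graph) → (V Γ → Bool) → Set
Bipartite Γ side = ∀ u v → Edge Γ u v → side u ≢ side v

Kernel : (Γ : Graph) → PermGroup (N Γ) → (V Γ → Bool) → (V Γ → V Γ) → Set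
Kernel Γ G side s = Mem G s × (∀ v → side (s v) ≡ side v)

prodAct : ∀ {n} → (Fin n → Fin n) → (Fin n → Fin n) → Fin n ⊎ Fin n → Fin n ⊎ Fin n
prodAct σ τ = map⊎ σ τ

record Lemma2p1Pair (n : ℕ) (L : PermGroup n) (N₀ : ℕ) : Set₁ where
  field
    Γ        : Graph
    G        : PermGroup (N Γ)
    G≤Aut    : IsAutGroup Γ G
    large    : N₀ < N Γ
    connected : Connected Γ
    valent    : Valent Γ n
    side      : V Γ → Bool
    bipartite : Bipartite Γ side
    locally   : LocallyL Γ G L
    cell      : V Γ → Fin n
    parts-nonempty : ∀ (b : Bool) (i : Fin n) → ∃[ v ] (side v ≡ b × cell v ≡ i)
    G-invariant    : ∀ g → Mem G g → ∀ u v →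
                       part Γ side cell u ≡ part Γ side cell v →
                       part Γ side cell (g u) ≡ part Γ side cell (g v)
    one-neighbour  : ∀ v → InX Γ side cell v → ∀ (i : Fin n) →
                       ∃! _≡_ (λ w → Edge Γ v w × Yi Γ side cell i w)
    f     : V Γ → V Γ
    f∈G   : Mem G f
    f²=1  : f ∘ f ≗ id
    fX    : ∀ i → ImageEq f (Xi Γ side cell i) (Yi Γ side cell i)
    fY    : ∀ i → ImageEq f (Yi Γ side cell i) (Xi Γ side cell i)
    G=⟨S,f⟩ : ∀ g → Mem G g ⇔ Generated (λ h → Kernel Γ G side h ⊎ h ≗ f) g
    Sᶠ=S    : ∀ s → Kernel Γ G side s ⇔ Kernel Γ G side (f ∘ s ∘ f)
    ψ       : (Fin n ⊎ Fin n) ↔ (Bool × Fin n)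
    S→L×L   : ∀ s → Kernel Γ G side s → ∃[ σ ] ∃[ τ ] (Mem L σ × Mem L τ ×
                (∀ x v → part Γ side cell v ≡ Inverse.to ψ x →
                   part Γ side cell (s v) ≡ Inverse.to ψ (prodAct σ τ x)))
    L×L→S   : ∀ σ τ → Mem L σ → Mem L τ → ∃[ s ] (Kernel Γ G side s ×
                (∀ x v → part Γ side cell v ≡ Inverse.to ψ x →
                   part Γ side cell (s v) ≡ Inverse.to ψ (prodAct σ τ x)))
    local-swap : ∀ v → InX Γ side cell v → ∀ π → Mem L π →
                   ∃[ s ] (Kernel Γ G side s × s v ≡ v ×
                     (∀ i → ImageEq s (Xi Γ side cell i) (Xi Γ side cell i)) ×
                     (∀ i → ImageEq s (Yi Γ side cell i) (Yi Γ side cell (π i))))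

{-# OPTIONS --safe #-}
module Submission where

-- The graph is the ℤ/m-homology cover of K_{n,n}, with m = N₀ + 1.  A vertex is a
-- side X or Y, an index i < n and an (n-1)×(n-1) matrix a over ℤ/m; the X-vertex
-- (i, a) is adjacent to the Y-vertex (j, a + E_ij), where E_ij is the matrix unit
-- in position (i-1, j-1), and is 0 when i = 0 or j = 0.  So every X-vertex has
-- exactly one neighbour in each Y_j and vice versa.  The walk X_0 Y_0 X_k Y_l X_0
-- adds E_kl to the matrix, and the E_kl generate all matrices because 1 generates
-- ℤ/m: the graph is connected.
--
-- G consists of the automorphisms that permute the parts X_i, Y_i through L on each
-- side, possibly exchanging X and Y.  It contains the translations a ↦ a + z, the
-- duality (X/Y, i, a) ↦ (Y/X, i, -aᵀ), and for σ ∈ L a map realising σ on the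
-- X-parts: viewing a as rows 1 … n-1 of the n × (n-1) matrix whose column sums are
-- 0 on X and the unit row e_j on Y_j, it permutes the n rows.  Conjugating by the
-- duality moves σ to the Y-parts, so the kernel on {X, Y} induces L × L, and after a
-- translation such an element fixes any given vertex; this gives vertex-transitivity
-- and the local action L.

open import Defs
open import Data.Nat using (ℕ; _≤_)

open import Algebra.Bundles using (AbelianGroup; Monoid)
open import Algebra.Structures using (IsAbelianGroup)
import Algebra.Properties.Monoid.Sum as MonoidSum
import Axiom.UniquenessOfIdentityProofs as UIP
open import Data.Bool using (Bool; true; false; not; _xor_; if_then_else_)
import Data.Bool.Properties as Bool
open import Data.Bool.Properties
  using (xor-assoc; xor-comm; xor-identityʳ; true-xor; xor-same; not-involutive; not-injective)
open import Data.Fin as Fin using (Fin; zero; suc; toℕ; _≟_; funToFin; finToFun)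
open import Data.Fin.Permutation as Perm using (Permutation′; _⟨$⟩ʳ_; _⟨$⟩ˡ_)
open import Data.Fin.Properties
  using (injective⇒≤; toℕ-injective; toℕ<n; toℕ-fromℕ<; all?; *↔×; 2↔Bool; finToFun-funToFin; funToFin-finToFin)
open import Data.Nat as ℕ using (NonZero; _∸_; _%_)
open import Data.Nat.DivMod using (_mod_; %-distribˡ-+; m<n⇒m%n≡m; [m+n]%n≡m%n)
import Data.Nat.Properties as ℕ
open import Data.Product using (∃-syntax; ∃!; _×_; _,_; proj₁; proj₂)
open import Data.Product.Function.NonDependent.Propositional using (_×-↔_)
open import Data.Sum using (_⊎_; inj₁; inj₂) renaming (swap to swap⊎; map to map⊎)
open import Function using (_∘_; id; _⇔_; mk⇔; _↔_; mk↔ₛ′; Inverse)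
open import Function.Properties.Inverse using (↔-trans; ↔-sym)
open import Level using (0ℓ)
open import Relation.Binary.Construct.Closure.ReflexiveTransitive using (Star; ε; _◅_; _◅◅_; reverse)
open import Relation.Binary.PropositionalEquality hiding ([_]; setoid)
open import Relation.Nullary using (Dec; does; proof; ¬_)
open import Relation.Nullary.Decidable using (map′; _×-dec_; _⊎-dec_; does-⇔; dec-true; dec-false)
open import Relation.Nullary.Reflects using (Reflects; invert)

module Cyclic (m : ℕ) .{{_ : NonZero m}} where

  [_] : ℕ → Fin m
  [ k ] = k mod m

  infixl 6 _+_
  _+_ : Fin m → Fin m → Fin m
  x + y = [ toℕ x ℕ.+ toℕ y ]

  -_ : Fin m → Fin m
  - x = [ m ∸ toℕ x ]

  0# 1# : Fin m
  0# = [ 0 ]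
  1# = [ 1 ]

  toℕ-[] : ∀ k → toℕ [ k ] ≡ k % m
  toℕ-[] k = toℕ-fromℕ< _

  []-toℕ : ∀ x → [ toℕ x ] ≡ x
  []-toℕ x = toℕ-injective (trans (toℕ-[] (toℕ x)) (m<n⇒m%n≡m (toℕ<n x)))

  []-+ : ∀ a b → [ a ℕ.+ b ] ≡ [ a ] + [ b ]
  []-+ a b = toℕ-injective (begin
    toℕ [ a ℕ.+ b ]                    ≡⟨ toℕ-[] (a ℕ.+ b) ⟩
    (a ℕ.+ b) % m                      ≡⟨ %-distribˡ-+ a b m ⟩
    (a % m ℕ.+ b % m) % m              ≡⟨ cong₂ (λ p q → (p ℕ.+ q) % m) (toℕ-[] a) (toℕ-[] b) ⟨
    (toℕ [ a ] ℕ.+ toℕ [ b ]) % m      ≡⟨ toℕ-[] _ ⟨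
    toℕ ([ a ] + [ b ])                ∎)
    where open ≡-Reasoning

  +-assoc : ∀ x y z → (x + y) + z ≡ x + (y + z)
  +-assoc x y z = begin
    (x + y) + z                        ≡⟨ cong (x + y +_) ([]-toℕ z) ⟨
    [ toℕ x ℕ.+ toℕ y ] + [ toℕ z ]    ≡⟨ []-+ (toℕ x ℕ.+ toℕ y) (toℕ z) ⟨
    [ toℕ x ℕ.+ toℕ y ℕ.+ toℕ z ]      ≡⟨ cong [_] (ℕ.+-assoc (toℕ x) (toℕ y) (toℕ z)) ⟩
    [ toℕ x ℕ.+ (toℕ y ℕ.+ toℕ z) ]    ≡⟨ []-+ (toℕ x) _ ⟩
    [ toℕ x ] + (y + z)                ≡⟨ cong (_+ (y + z)) ([]-toℕ x) ⟩
    x + (y + z)                        ∎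
    where open ≡-Reasoning

  +-comm : ∀ x y → x + y ≡ y + x
  +-comm x y = cong [_] (ℕ.+-comm (toℕ x) (toℕ y))

  +-identityˡ : ∀ x → 0# + x ≡ x
  +-identityˡ x = begin
    0# + x             ≡⟨ cong (0# +_) ([]-toℕ x) ⟨
    [ 0 ] + [ toℕ x ]  ≡⟨ []-+ 0 (toℕ x) ⟨
    [ toℕ x ]          ≡⟨ []-toℕ x ⟩
    x                  ∎
    where open ≡-Reasoning

  [m]≡0# : [ m ] ≡ 0#
  [m]≡0# = toℕ-injective (trans (toℕ-[] m) (trans ([m+n]%n≡m%n 0 m) (sym (toℕ-[] 0))))

  +-inverseʳ : ∀ x → x + - x ≡ 0#
  +-inverseʳ x = begin
    x + - x                        ≡⟨ cong (_+ - x) ([]-toℕ x) ⟨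
    [ toℕ x ] + [ m ∸ toℕ x ]      ≡⟨ []-+ (toℕ x) (m ∸ toℕ x) ⟨
    [ toℕ x ℕ.+ (m ∸ toℕ x) ]      ≡⟨ cong [_] (ℕ.m+[n∸m]≡n (ℕ.<⇒≤ (toℕ<n x))) ⟩
    [ m ]                          ≡⟨ [m]≡0# ⟩
    0#                             ∎
    where open ≡-Reasoning

  +-isAbelianGroup : IsAbelianGroup _≡_ _+_ 0# -_
  +-isAbelianGroup = record
    { isGroup = record
      { isMonoid = record
        { isSemigroup = record
          { isMagma = record { isEquivalence = isEquivalence ; ∙-cong = cong₂ _+_ }
          ; assoc = +-assoc
          }
        ; identity = +-identityˡ , λ x → trans (+-comm x 0#) (+-identityˡ x)
        }
      ; inverse = (λ x → trans (+-comm (- x) x) (+-inverseʳ x)) , +-inverseʳ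
      ; ⁻¹-cong = cong -_
      }
    ; comm = +-comm
    }

  +-abelianGroup : AbelianGroup 0ℓ 0ℓ
  +-abelianGroup = record { isAbelianGroup = +-isAbelianGroup }

  open import Algebra.Definitions.RawMonoid (AbelianGroup.rawMonoid +-abelianGroup)
    using () renaming (_×_ to _·_) public

  ·1#≡[] : ∀ k → k · 1# ≡ [ k ]
  ·1#≡[] ℕ.zero    = refl
  ·1#≡[] (ℕ.suc k) = trans (cong (1# +_) (·1#≡[] k)) (sym ([]-+ 1 k))

  1#-generates : ∀ x → toℕ x · 1# ≡ x
  1#-generates x = trans (·1#≡[] (toℕ x)) ([]-toℕ x)

module Kronecker {c ℓ} (M : Monoid c ℓ) where

  open Monoid M
    using (Carrier; _≈_; setoid; ∙-congˡ; identityˡ; identityʳ)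
    renaming (_∙_ to _+_; ε to 0#; refl to ≈-refl; sym to ≈-sym; trans to ≈-trans)
  open MonoidSum M using (sum; sum-replicate-zero)
  open import Relation.Binary.Reasoning.Setoid setoid

  δ : ∀ {r} → Fin r → Fin r → Carrier → Carrier
  δ i j x = if does (i ≟ j) then x else 0#

  sum-δ : ∀ {r} (i : Fin r) (f : Fin r → Carrier) → sum (λ j → δ i j (f j)) ≈ f i
  sum-δ {ℕ.suc r} zero    f = begin
    f zero + sum {r} (λ _ → 0#)  ≈⟨ ∙-congˡ (sum-replicate-zero r) ⟩
    f zero + 0#                  ≈⟨ identityʳ (f zero) ⟩
    f zero                       ∎
  sum-δ {ℕ.suc r} (suc i) f = ≈-trans (identityˡ _) (sum-δ i (f ∘ suc))

  δ-sym : ∀ {r} (i j : Fin r) x → δ i j x ≡ δ j i x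
  δ-sym i j x = cong (λ b → if b then x else 0#) (does-⇔ (mk⇔ sym sym) (i ≟ j) (j ≟ i))

  δ-permute : ∀ {r} (π : Permutation′ r) i j x → δ i (π ⟨$⟩ˡ j) x ≡ δ (π ⟨$⟩ʳ i) j x
  δ-permute π i j x = cong (λ b → if b then x else 0#) (does-⇔ (mk⇔ to from) (i ≟ π ⟨$⟩ˡ j) (π ⟨$⟩ʳ i ≟ j))
    where
    to : i ≡ π ⟨$⟩ˡ j → π ⟨$⟩ʳ i ≡ j
    to refl = Perm.inverseʳ π
    from : π ⟨$⟩ʳ i ≡ j → i ≡ π ⟨$⟩ˡ j
    from refl = sym (Perm.inverseˡ π)

  δ-comm : ∀ {r r′} (i j : Fin r) (k l : Fin r′) x → δ i j (δ k l x) ≡ δ k l (δ i j x)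
  δ-comm i j k l x with does (i ≟ j) | does (k ≟ l)
  ... | true  | true  = refl
  ... | true  | false = refl
  ... | false | true  = refl
  ... | false | false = refl

  δ-zero : ∀ {r} (i j : Fin r) → δ i j 0# ≡ 0#
  δ-zero i j with does (i ≟ j)
  ... | true  = refl
  ... | false = refl

  δ-homo : ∀ {r} (i j : Fin r) x y → δ i j (x + y) ≈ δ i j x + δ i j y
  δ-homo i j x y with does (i ≟ j)
  ... | true  = ≈-refl
  ... | false = ≈-sym (identityʳ 0#)

  δ-sum : ∀ {r s} (i j : Fin r) (f : Fin s → Carrier) → δ i j (sum f) ≈ sum (λ k → δ i j (f k))
  δ-sum {s = s} i j f with does (i ≟ j)
  ... | true  = ≈-refl
  ... | false = ≈-sym (sum-replicate-zero s)

funToFin-cong : ∀ {k l} {f g : Fin k → Fin l} → f ≗ g → funToFin f ≡ funToFin g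
funToFin-cong {ℕ.zero}  f≗g = refl
funToFin-cong {ℕ.suc k} f≗g = cong₂ Fin.combine (f≗g zero) (funToFin-cong (f≗g ∘ suc))

xor-involutiveʳ : ∀ x b → (x xor b) xor b ≡ x
xor-involutiveʳ x b = begin
  (x xor b) xor b    ≡⟨ xor-assoc x b b ⟩
  x xor (b xor b)    ≡⟨ cong (x xor_) (xor-same b) ⟩
  x xor false        ≡⟨ xor-identityʳ x ⟩
  x                  ∎
  where open ≡-Reasoning

xor-cancelʳ : ∀ {x y} b → x xor b ≡ y → x ≡ y xor b
xor-cancelʳ {x} b e = trans (sym (xor-involutiveʳ x b)) (cong (_xor b) e)

record IsAutomorphism (Γ : Graph) (g : V Γ → V Γ) : Set where
  field
    inverse        : V Γ → V Γ
    inverseˡ       : ∀ v → inverse (g v) ≡ v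
    inverseʳ       : ∀ v → g (inverse v) ≡ v
    adj-preserving : ∀ u v → adj Γ (g u) (g v) ≡ adj Γ u v

module _ {Γ : Graph} where

  isAutomorphism-id : IsAutomorphism Γ id
  isAutomorphism-id = record
    { inverse = id ; inverseˡ = λ _ → refl ; inverseʳ = λ _ → refl ; adj-preserving = λ _ _ → refl }

  isAutomorphism-∘ : ∀ {g h} → IsAutomorphism Γ g → IsAutomorphism Γ h → IsAutomorphism Γ (g ∘ h)
  isAutomorphism-∘ {g} {h} G H = record
    { inverse        = H.inverse ∘ G.inverse
    ; inverseˡ       = λ v → trans (cong H.inverse (G.inverseˡ (h v))) (H.inverseˡ v)
    ; inverseʳ       = λ v → trans (cong g (H.inverseʳ (G.inverse v))) (G.inverseʳ v)
    ; adj-preserving = λ u v → trans (G.adj-preserving (h u) (h v)) (H.adj-preserving u v)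
    }
    where
    module G = IsAutomorphism G
    module H = IsAutomorphism H

  isAutomorphism-inverse : ∀ {g} (G : IsAutomorphism Γ g) → IsAutomorphism Γ (IsAutomorphism.inverse G)
  isAutomorphism-inverse {g} G = record
    { inverse        = g
    ; inverseˡ       = inverseʳ
    ; inverseʳ       = inverseˡ
    ; adj-preserving = λ u v → trans (sym (adj-preserving (inverse u) (inverse v)))
                                     (cong₂ (adj Γ) (inverseʳ u) (inverseʳ v))
    }
    where open IsAutomorphism G

  isAutomorphism-resp : ∀ {g h} → g ≗ h → IsAutomorphism Γ g → IsAutomorphism Γ h
  isAutomorphism-resp {g} {h} g≗h G = record
    { inverse        = inverse
    ; inverseˡ       = λ v → trans (cong inverse (sym (g≗h v))) (inverseˡ v)
    ; inverseʳ       = λ v → trans (sym (g≗h (inverse v))) (inverseʳ v)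
    ; adj-preserving = λ u v → trans (cong₂ (adj Γ) (sym (g≗h u)) (sym (g≗h v))) (adj-preserving u v)
    }
    where open IsAutomorphism G

module PartPreserving {n} (Γ : Graph) (side : V Γ → Bool) (cell : V Γ → Fin n) (L : PermGroup n) where

  MapsParts : (V Γ → V Γ) → Bool → (Bool → Fin n → Fin n) → Set
  MapsParts g b ρ = ∀ v → side (g v) ≡ side v xor b × cell (g v) ≡ ρ (side v) (cell v)

  record Member (g : V Γ → V Γ) : Set where
    field
      automorphism : IsAutomorphism Γ g
      flip         : Bool
      ρ            : Bool → Fin n → Fin n
      ρ∈L          : ∀ s → Mem L (ρ s)
      maps-parts   : MapsParts g flip ρ

    side-map : ∀ v → side (g v) ≡ side v xor flip
    side-map v = proj₁ (maps-parts v)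

    cell-map : ∀ v → cell (g v) ≡ ρ (side v) (cell v)
    cell-map v = proj₂ (maps-parts v)

    open IsAutomorphism automorphism public

  open Member

  member-resp : ∀ {g h} → g ≗ h → Member g → Member h
  member-resp g≗h G = record
    { automorphism = isAutomorphism-resp g≗h (automorphism G)
    ; flip         = flip G
    ; ρ            = ρ G
    ; ρ∈L          = ρ∈L G
    ; maps-parts   = λ v → subst (λ w → side w ≡ _ × cell w ≡ _) (g≗h v) (maps-parts G v)
    }

  member-id : Member id
  member-id = record
    { automorphism = isAutomorphism-id
    ; flip         = false
    ; ρ            = λ _ → id
    ; ρ∈L          = λ _ → id∈ L
    ; maps-parts   = λ v → sym (xor-identityʳ (side v)) , refl
    }

  member-∘ : ∀ {g h} → Member g → Member h → Member (g ∘ h)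
  member-∘ {g} {h} G H = record
    { automorphism = isAutomorphism-∘ (automorphism G) (automorphism H)
    ; flip         = flip H xor flip G
    ; ρ            = λ s → ρ G (s xor flip H) ∘ ρ H s
    ; ρ∈L          = λ s → ∘∈ L (ρ∈L G _) (ρ∈L H s)
    ; maps-parts   = λ v →
        trans (side-map G (h v)) (trans (cong (_xor flip G) (side-map H v)) (xor-assoc (side v) _ _)) ,
        trans (cell-map G (h v)) (cong₂ (ρ G) (side-map H v) (cell-map H v))
    }

  member-inverse : ∀ {g} → Member g → ∃[ h ] (Member h × h ∘ g ≗ id × g ∘ h ≗ id)
  member-inverse {g} G = inverse G , G⁻¹ , inverseˡ G , inverseʳ G
    where
    ρ⁻¹ : Bool → Fin n → Fin n
    ρ⁻¹ s = proj₁ (inv∈ L (ρ∈L G (s xor flip G)))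

    ρ⁻¹-ρ : ∀ s i → ρ⁻¹ s (ρ G (s xor flip G) i) ≡ i
    ρ⁻¹-ρ s = proj₁ (proj₂ (proj₂ (inv∈ L (ρ∈L G (s xor flip G)))))

    side-inverse : ∀ v → side (inverse G v) ≡ side v xor flip G
    side-inverse v = xor-cancelʳ (flip G) (trans (sym (side-map G _)) (cong side (inverseʳ G v)))

    cell-inverse : ∀ v → cell (inverse G v) ≡ ρ⁻¹ (side v) (cell v)
    cell-inverse v = begin
      cell w                                          ≡⟨ ρ⁻¹-ρ (side v) _ ⟨
      ρ⁻¹ (side v) (ρ G (side v xor flip G) (cell w))  ≡⟨ cong (λ s → ρ⁻¹ (side v) (ρ G s (cell w))) (side-inverse v) ⟨
      ρ⁻¹ (side v) (ρ G (side w) (cell w))            ≡⟨ cong (ρ⁻¹ (side v)) (cell-map G w) ⟨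
      ρ⁻¹ (side v) (cell (g w))                       ≡⟨ cong (ρ⁻¹ (side v) ∘ cell) (inverseʳ G v) ⟩
      ρ⁻¹ (side v) (cell v)                           ∎
      where
      open ≡-Reasoning
      w = inverse G v

    G⁻¹ : Member (inverse G)
    G⁻¹ = record
      { automorphism = isAutomorphism-inverse (automorphism G)
      ; flip         = flip G
      ; ρ            = ρ⁻¹
      ; ρ∈L          = λ s → proj₁ (proj₂ (inv∈ L (ρ∈L G (s xor flip G))))
      ; maps-parts   = λ v → side-inverse v , cell-inverse v
      }

  partGroup : PermGroup (N Γ)
  partGroup = record
    { Mem = Member ; resp = member-resp ; id∈ = member-id ; ∘∈ = member-∘ ; inv∈ = member-inverse }

  part-map : ∀ {g} (G : Member g) v → part Γ side cell (g v) ≡ (side v xor flip G , ρ G (side v) (cell v))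
  part-map G v = cong₂ _,_ (side-map G v) (cell-map G v)

  preserves-partition : ∀ {g} → Member g → ∀ u v →
                        part Γ side cell u ≡ part Γ side cell v →
                        part Γ side cell (g u) ≡ part Γ side cell (g v)
  preserves-partition G u v e = trans (part-map G u)
    (trans (cong (λ (s , i) → s xor flip G , ρ G s i) e) (sym (part-map G v)))

  ρ-injective : ∀ {g} (G : Member g) s {i j} → ρ G s i ≡ ρ G s j → i ≡ j
  ρ-injective G s {i} {j} e = trans (sym (σ⁻¹σ i)) (trans (cong σ⁻¹ e) (σ⁻¹σ j))
    where
    σ⁻¹ = proj₁ (inv∈ L (ρ∈L G s))
    σ⁻¹σ = proj₁ (proj₂ (proj₂ (inv∈ L (ρ∈L G s))))

  InPart : Bool → Fin n → V Γ → Set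
  InPart s i v = side v ≡ s × cell v ≡ i

  image-part : ∀ {g} (G : Member g) s i → ImageEq g (InPart s i) (InPart (s xor flip G) (ρ G s i))
  image-part {g} G s i = forward , backward
    where
    forward : ∀ v → InPart s i v → InPart (s xor flip G) (ρ G s i) (g v)
    forward v (refl , refl) = side-map G v , cell-map G v

    backward : ∀ w → InPart (s xor flip G) (ρ G s i) w → ∃[ v ] (InPart s i v × g v ≡ w)
    backward w (w-side , w-cell) = inverse G w , (v-side , v-cell) , inverseʳ G w
      where
      open ≡-Reasoning
      v = inverse G w
      gv≡w = inverseʳ G w
      v-side : side v ≡ s
      v-side = begin
        side v                       ≡⟨ xor-cancelʳ (flip G) (trans (sym (side-map G v)) (cong side gv≡w)) ⟩
        side w xor flip G            ≡⟨ cong (_xor flip G) w-side ⟩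
        (s xor flip G) xor flip G    ≡⟨ xor-involutiveʳ s (flip G) ⟩
        s                            ∎
      v-cell : cell v ≡ i
      v-cell = ρ-injective G s (begin
        ρ G s (cell v)               ≡⟨ cong (λ t → ρ G t (cell v)) v-side ⟨
        ρ G (side v) (cell v)        ≡⟨ cell-map G v ⟨
        cell (g v)                   ≡⟨ cong cell gv≡w ⟩
        cell w                       ≡⟨ w-cell ⟩
        ρ G s i                      ∎)

  S : (V Γ → V Γ) → Set
  S = Kernel Γ partGroup side

  kernel : ∀ {s} (K : Member s) → flip K ≡ false → S s
  kernel K unflipped = K , λ v → trans (side-map K v) (trans (cong (side v xor_) unflipped) (xor-identityʳ (side v)))

  side-swapped : ∀ {f} (F : Member f) → flip F ≡ true → ∀ v → side (f v) ≡ not (side v)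
  side-swapped F flipped v =
    trans (side-map F v) (trans (cong (side v xor_) flipped) (trans (xor-comm (side v) true) (true-xor (side v))))

  ψ : (Fin n ⊎ Fin n) ↔ (Bool × Fin n)
  ψ = mk↔ₛ′ to from to-from from-to
    where
    to : Fin n ⊎ Fin n → Bool × Fin n
    to (inj₁ i) = false , i
    to (inj₂ j) = true , j
    from : Bool × Fin n → Fin n ⊎ Fin n
    from (false , i) = inj₁ i
    from (true , j)  = inj₂ j
    to-from : ∀ p → to (from p) ≡ p
    to-from (false , i) = refl
    to-from (true , j)  = refl
    from-to : ∀ x → from (to x) ≡ x
    from-to (inj₁ i) = refl
    from-to (inj₂ j) = refl

  ActsBy : (V Γ → V Γ) → (Fin n → Fin n) → (Fin n → Fin n) → Set
  ActsBy s σ τ = ∀ x v → part Γ side cell v ≡ Inverse.to ψ x →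
                         part Γ side cell (s v) ≡ Inverse.to ψ (prodAct σ τ x)

  acts-by : ∀ {s σ τ} (K : Member s) → (∀ v → side (s v) ≡ side v) → ρ K false ≗ σ → ρ K true ≗ τ →
            ActsBy s σ τ
  acts-by K s-side ρ≗σ ρ≗τ (inj₁ i) v e = cong₂ _,_ (trans (s-side v) (cong proj₁ e))
    (trans (cell-map K v) (trans (cong (λ (s , j) → ρ K s j) e) (ρ≗σ i)))
  acts-by K s-side ρ≗σ ρ≗τ (inj₂ j) v e = cong₂ _,_ (trans (s-side v) (cong proj₁ e))
    (trans (cell-map K v) (trans (cong (λ (s , i) → ρ K s i) e) (ρ≗τ j)))

  module Swapping {f} (F : Member f) (flipped : flip F ≡ true) (f-involutive : f ∘ f ≗ id) where

    Generator : (V Γ → V Γ) → Set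
    Generator h = S h ⊎ h ≗ f

    generated : ∀ {g} → Member g → Generated Generator g
    generated {g} G with flip G in unflipped
    ... | false = gen (inj₁ (kernel G unflipped))
    ... | true  = gresp (λ v → f-involutive (g v)) (comp (gen (inj₂ λ _ → refl)) (gen (inj₁ fg∈S)))
      where fg∈S = kernel (member-∘ F G) (cong₂ _xor_ unflipped flipped)

    generated⇒member : ∀ {g} → Generated Generator g → Member g
    generated⇒member (gen (inj₁ (G , _)))    = G
    generated⇒member (gen (inj₂ g≗f))        = member-resp (λ v → sym (g≗f v)) F
    generated⇒member one                     = member-id
    generated⇒member (comp p q)              = member-∘ (generated⇒member p) (generated⇒member q)
    generated⇒member (ginv {h = h} p hg≗id _) = member-resp g⁻¹≗h (proj₁ (proj₂ (member-inverse G)))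
      where
      G = generated⇒member p
      g⁻¹≗h : inverse G ≗ h
      g⁻¹≗h v = trans (sym (hg≗id (inverse G v))) (cong h (inverseʳ G v))
    generated⇒member (gresp g≗h p)           = member-resp g≗h (generated⇒member p)

    kernel-conjugate : ∀ s → S s ⇔ S (f ∘ s ∘ f)
    kernel-conjugate s = mk⇔ to from
      where
      open ≡-Reasoning
      f-side = side-swapped F flipped
      to : S s → S (f ∘ s ∘ f)
      to (K , s-side) = member-∘ (member-∘ F K) F , λ v →
        trans (f-side _) (trans (cong not (trans (s-side (f v)) (f-side v))) (not-involutive (side v)))
      from : S (f ∘ s ∘ f) → S s
      from (K , fsf-side) =
        member-resp (λ v → trans (f-involutive _) (cong s (f-involutive v))) (member-∘ (member-∘ F K) F) ,
        λ v → not-injective (begin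
          not (side (s v))              ≡⟨ cong (not ∘ side ∘ s) (f-involutive v) ⟨
          not (side (s (f (f v))))      ≡⟨ f-side _ ⟨
          side (f (s (f (f v))))        ≡⟨ fsf-side (f v) ⟩
          side (f v)                    ≡⟨ f-side v ⟩
          not (side v)                  ∎)

    into-X : ∀ w → ∃[ h ] (Member h × side (h w) ≡ false × h ∘ h ≗ id)
    into-X w with side w in w-side
    ... | false = id , member-id , w-side , λ _ → refl
    ... | true  = f , F , trans (side-swapped F flipped w) (cong not w-side) , f-involutive

    vertex-transitive : (∀ u v → side u ≡ false → side v ≡ false → ∃[ g ] (Member g × g u ≡ v)) →
                        VertexTransitive partGroup
    vertex-transitive X-transitive u v =
      let hᵤ , Hᵤ , u-side , _             = into-X u
          hᵥ , Hᵥ , v-side , hᵥ-involutive = into-X v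
          g , G , g-maps                   = X-transitive (hᵤ u) (hᵥ v) u-side v-side
      in  hᵥ ∘ g ∘ hᵤ , member-∘ (member-∘ Hᵥ G) Hᵤ , trans (cong hᵥ g-maps) (hᵥ-involutive v)

-- The cover of K_{n,n}

module Cover (n' m : ℕ) .{{_ : NonZero m}} where

  open Cyclic m
  open AbelianGroup +-abelianGroup using (commutativeMonoid; monoid; identityˡ; identityʳ; assoc)
  open import Algebra.Properties.AbelianGroup +-abelianGroup
    using (⁻¹-involutive; ⁻¹-∙-comm; //-rightDividesˡ; //-rightDividesʳ)
  open import Algebra.Properties.CommutativeSemigroup (AbelianGroup.commutativeSemigroup +-abelianGroup)
    using (xy∙z≈xz∙y)
  open import Algebra.Properties.CommutativeMonoid.Sum commutativeMonoid
    using (sum; sum-cong-≗; sum-permute; ∑-distrib-+)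
  open Kronecker monoid

  n : ℕ
  n = ℕ.suc n'

  Matrix : ℕ → Set
  Matrix r = Fin r → Fin n' → Fin m

  infix 4 _≈ₘ_
  _≈ₘ_ : ∀ {r} → Matrix r → Matrix r → Set
  A ≈ₘ B = ∀ k l → A k l ≡ B k l

  infixl 6 _+ₘ_
  _+ₘ_ : ∀ {r} → Matrix r → Matrix r → Matrix r
  (A +ₘ B) k l = A k l + B k l

  -ₘ_ : ∀ {r} → Matrix r → Matrix r
  (-ₘ A) k l = - A k l

  0ₘ : ∀ {r} → Matrix r
  0ₘ _ _ = 0#

  colsum : ∀ {r} → Matrix r → Fin n' → Fin m
  colsum A l = sum (λ k → A k l)

  restrict : Matrix n → Matrix n'
  restrict A k = A (suc k)

  extend : (Fin n' → Fin m) → Matrix n' → Matrix n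
  extend t a zero    l = t l + - colsum a l
  extend t a (suc k) l = a k l

  colsum-extend : ∀ t a l → colsum (extend t a) l ≡ t l
  colsum-extend t a l = //-rightDividesˡ (colsum a l) (t l)

  extend-unique : ∀ {t a} A → (∀ l → colsum A l ≡ t l) → restrict A ≈ₘ a → extend t a ≈ₘ A
  extend-unique {t} {a} A A-sums A-rest zero l = begin
    t l + - colsum a l                       ≡⟨ cong₂ (λ x y → x + - y) (A-sums l) (sum-cong-≗ (λ k → A-rest k l)) ⟨
    colsum A l + - colsum (restrict A) l     ≡⟨ //-rightDividesʳ (colsum (restrict A) l) (A zero l) ⟩
    A zero l                                 ∎
    where open ≡-Reasoning
  extend-unique A A-sums A-rest (suc k) l = sym (A-rest k l)

  colsum-permute : ∀ (π : Permutation′ n) A l → colsum (λ r → A (π ⟨$⟩ˡ r)) l ≡ colsum A l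
  colsum-permute π A l = sym (sum-permute (λ r → A r l) (Perm.flip π))

  -- Column l : Fin n' stands for the index suc l : Fin n, and row k of a Matrix n' for
  -- row suc k of a Matrix n; so elementary i j vanishes for j = 0, and voltage i j also
  -- for i = 0.
  unitRow : Fin n → Fin n' → Fin m
  unitRow j l = δ j (suc l) 1#

  elementary : Fin n → Fin n → Matrix n
  elementary i j r l = δ i r (unitRow j l)

  voltage : Fin n → Fin n → Matrix n'
  voltage i j = restrict (elementary i j)

  colsum-elementary : ∀ i j l → colsum (elementary i j) l ≡ unitRow j l
  colsum-elementary i j l = sum-δ i (λ _ → unitRow j l)

  voltage-transpose : ∀ i j k l → voltage i j k l ≡ voltage j i l k
  voltage-transpose i j k l = δ-comm i (suc k) j (suc l) 1#

  voltage-zeroʳ : ∀ i → voltage i zero ≈ₘ 0ₘ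
  voltage-zeroʳ i k l = δ-zero i (suc k)

  record Label : Set where
    constructor ⟨_,_,_⟩
    field
      side : Bool
      cell : Fin n
      mat  : Matrix n'

  open Label

  infix 4 _≈ₗ_
  record _≈ₗ_ (d e : Label) : Set where
    constructor same
    field
      side-≡ : side d ≡ side e
      cell-≡ : cell d ≡ cell e
      mat-≈  : mat d ≈ₘ mat e

  open _≈ₗ_

  ≈ₗ-refl : ∀ {d} → d ≈ₗ d
  ≈ₗ-refl = same refl refl λ _ _ → refl

  ≈ₗ-sym : ∀ {d e} → d ≈ₗ e → e ≈ₗ d
  ≈ₗ-sym (same p q r) = same (sym p) (sym q) λ k l → sym (r k l)

  ≈ₗ-trans : ∀ {d e f} → d ≈ₗ e → e ≈ₗ f → d ≈ₗ f
  ≈ₗ-trans (same p q r) (same p′ q′ r′) = same (trans p p′) (trans q q′) λ k l → trans (r k l) (r′ k l)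

  record Link (d e : Label) : Set where
    constructor link
    field
      X-end  : side d ≡ false
      Y-end  : side e ≡ true
      offset : mat e ≈ₘ mat d +ₘ voltage (cell d) (cell e)

  Adjacent : Label → Label → Set
  Adjacent d e = Link d e ⊎ Link e d

  link? : ∀ d e → Dec (Link d e)
  link? d e = map′ (λ (X , Y , o) → link X Y o) (λ (link X Y o) → X , Y , o)
    ((side d Bool.≟ false) ×-dec (side e Bool.≟ true) ×-dec
     all? (λ k → all? (λ l → mat e k l Fin.≟ (mat d +ₘ voltage (cell d) (cell e)) k l)))

  adjacent? : ∀ d e → Dec (Adjacent d e)
  adjacent? d e = link? d e ⊎-dec link? e d

  link-resp : ∀ {d d′ e e′} → d ≈ₗ d′ → e ≈ₗ e′ → Link d e → Link d′ e′
  link-resp (same ds dc dm) (same es ec em) (link d-side e-side e-mat) =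
    link (trans (sym ds) d-side) (trans (sym es) e-side) λ k l →
      trans (sym (em k l)) (trans (e-mat k l) (cong₂ _+_ (dm k l) (cong₂ (λ i j → voltage i j k l) dc ec)))

  adjacent-resp : ∀ {d d′ e e′} → d ≈ₗ d′ → e ≈ₗ e′ → Adjacent d e → Adjacent d′ e′
  adjacent-resp d≈ e≈ (inj₁ de) = inj₁ (link-resp d≈ e≈ de)
  adjacent-resp d≈ e≈ (inj₂ ed) = inj₂ (link-resp e≈ d≈ ed)

  ¬adjacent-refl : ∀ d → ¬ Adjacent d d
  ¬adjacent-refl d (inj₁ (link X Y _)) with () ← trans (sym X) Y
  ¬adjacent-refl d (inj₂ (link X Y _)) with () ← trans (sym X) Y

  MatCode : Set
  MatCode = Fin ((m ℕ.^ n') ℕ.^ n')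

  encodeMat : Matrix n' → MatCode
  encodeMat a = funToFin (λ k → funToFin (a k))

  decodeMat : MatCode → Matrix n'
  decodeMat x k = finToFun (finToFun x k)

  decodeMat-encodeMat : ∀ a → decodeMat (encodeMat a) ≈ₘ a
  decodeMat-encodeMat a k l =
    trans (cong (λ y → finToFun y l) (finToFun-funToFin _ k)) (finToFun-funToFin (a k) l)

  encodeMat-decodeMat : ∀ x → encodeMat (decodeMat x) ≡ x
  encodeMat-decodeMat x =
    trans (funToFin-cong {n'} {m ℕ.^ n'} (λ k → funToFin-finToFin {n'} {m} (finToFun x k)))
          (funToFin-finToFin {n'} {m ℕ.^ n'} x)

  encodeMat-cong : ∀ {a b} → a ≈ₘ b → encodeMat a ≡ encodeMat b
  encodeMat-cong a≈b = funToFin-cong {n'} {m ℕ.^ n'} (λ k → funToFin-cong {n'} {m} (a≈b k))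

  order : ℕ
  order = 2 ℕ.* (n ℕ.* (m ℕ.^ n') ℕ.^ n')

  opaque
    coordinates : Fin order ↔ (Bool × Fin n × MatCode)
    coordinates = ↔-trans *↔× (2↔Bool ×-↔ *↔×)

    label : Fin order → Label
    label v = ⟨ proj₁ (Inverse.to coordinates v) , proj₁ (proj₂ (Inverse.to coordinates v)) ,
                decodeMat (proj₂ (proj₂ (Inverse.to coordinates v))) ⟩

    vertex : Label → Fin order
    vertex d = Inverse.from coordinates (side d , cell d , encodeMat (mat d))

    label-vertex : ∀ d → label (vertex d) ≈ₗ d
    label-vertex d = same (cong proj₁ coords) (cong (proj₁ ∘ proj₂) coords) λ k l →
      trans (cong (λ (_ , _ , x) → decodeMat x k l) coords) (decodeMat-encodeMat (mat d) k l)
      where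
      coords : Inverse.to coordinates (vertex d) ≡ (side d , cell d , encodeMat (mat d))
      coords = Inverse.strictlyInverseˡ coordinates (side d , cell d , encodeMat (mat d))

    vertex-label : ∀ v → vertex (label v) ≡ v
    vertex-label v = trans (cong (λ x → Inverse.from coordinates (s , i , x)) (encodeMat-decodeMat x))
                           (Inverse.strictlyInverseʳ coordinates v)
      where
      s : Bool
      s = proj₁ (Inverse.to coordinates v)
      i : Fin n
      i = proj₁ (proj₂ (Inverse.to coordinates v))
      x : MatCode
      x = proj₂ (proj₂ (Inverse.to coordinates v))

    vertex-cong : ∀ {d e} → d ≈ₗ e → vertex d ≡ vertex e
    vertex-cong (same p q r) = cong (Inverse.from coordinates) (cong₂ _,_ p (cong₂ _,_ q (encodeMat-cong r)))

  Γ : Graph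
  Γ = record
    { N          = order
    ; adj        = λ u v → does (adjacent? (label u) (label v))
    ; adj-sym    = λ u v → does-⇔ (mk⇔ swap⊎ swap⊎) (adjacent? (label u) (label v))
                                                     (adjacent? (label v) (label u))
    ; adj-irrefl = λ v → dec-false (adjacent? (label v) (label v)) (¬adjacent-refl (label v))
    }

  Vertex : Set
  Vertex = V Γ

  sideᵛ : Vertex → Bool
  sideᵛ = side ∘ label

  cellᵛ : Vertex → Fin n
  cellᵛ = cell ∘ label

  matᵛ : Vertex → Matrix n'
  matᵛ = mat ∘ label

  edge⇒adjacent : ∀ {u v} → Edge Γ u v → Adjacent (label u) (label v)
  edge⇒adjacent {u} {v} e = invert (subst (Reflects _) e (proof (adjacent? (label u) (label v))))

  adjacent⇒edge : ∀ {u v} → Adjacent (label u) (label v) → Edge Γ u v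
  adjacent⇒edge {u} {v} = dec-true (adjacent? (label u) (label v))

  edge-sym : ∀ {u v} → Edge Γ u v → Edge Γ v u
  edge-sym {u} {v} e = trans (adj-sym Γ v u) e

  bipartite : Bipartite Γ sideᵛ
  bipartite u v e same-side with edge⇒adjacent e
  ... | inj₁ (link X Y _) with () ← trans (sym X) (trans same-side Y)
  ... | inj₂ (link X Y _) with () ← trans (sym Y) (trans same-side X)

  parts-nonempty : ∀ s i → ∃[ v ] (sideᵛ v ≡ s × cellᵛ v ≡ i)
  parts-nonempty s i = vertex ⟨ s , i , 0ₘ ⟩ , side-≡ (label-vertex _) , cell-≡ (label-vertex _)

  m≤order : Fin n' → m ℕ.≤ order
  m≤order k = injective⇒≤ {f = λ x → vertex ⟨ false , zero , (λ _ _ → x) ⟩} λ e →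
    trans (sym (mat-≈ (label-vertex _) k k)) (trans (cong (λ v → matᵛ v k k) e) (mat-≈ (label-vertex _) k k))

  neighbour : Label → Fin n → Label
  neighbour ⟨ false , i , a ⟩ j = ⟨ true  , j , a +ₘ voltage i j ⟩
  neighbour ⟨ true  , j , b ⟩ i = ⟨ false , i , b +ₘ -ₘ voltage i j ⟩

  adjacent-neighbour : ∀ d j → Adjacent d (neighbour d j)
  adjacent-neighbour ⟨ false , i , a ⟩ j = inj₁ (link refl refl λ _ _ → refl)
  adjacent-neighbour ⟨ true  , j , b ⟩ i =
    inj₂ (link refl refl λ k l → sym (//-rightDividesˡ (voltage i j k l) (b k l)))

  neighbour-unique : ∀ d e → Adjacent d e → neighbour d (cell e) ≈ₗ e
  neighbour-unique ⟨ .false , i , a ⟩ ⟨ .true , j , b ⟩ (inj₁ (link refl refl b≈)) =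
    same refl refl λ k l → sym (b≈ k l)
  neighbour-unique ⟨ .true , j , b ⟩ ⟨ .false , i , a ⟩ (inj₂ (link refl refl b≈)) =
    same refl refl λ k l → trans (cong (_+ - voltage i j k l) (b≈ k l)) (//-rightDividesʳ (voltage i j k l) (a k l))

  side-neighbour : ∀ d j → side (neighbour d j) ≡ not (side d)
  side-neighbour ⟨ false , _ , _ ⟩ j = refl
  side-neighbour ⟨ true  , _ , _ ⟩ j = refl

  cell-neighbour : ∀ d j → cell (neighbour d j) ≡ j
  cell-neighbour ⟨ false , _ , _ ⟩ j = refl
  cell-neighbour ⟨ true  , _ , _ ⟩ j = refl

  nbr : Vertex → Fin n → Vertex
  nbr v j = vertex (neighbour (label v) j)

  nbr-edge : ∀ v j → Edge Γ v (nbr v j)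
  nbr-edge v j = adjacent⇒edge {v} {nbr v j}
    (adjacent-resp ≈ₗ-refl (≈ₗ-sym (label-vertex (neighbour (label v) j))) (adjacent-neighbour (label v) j))

  nbr-unique : ∀ {v w} → Edge Γ v w → w ≡ nbr v (cellᵛ w)
  nbr-unique {v} {w} e =
    trans (sym (vertex-label w)) (sym (vertex-cong (neighbour-unique (label v) (label w) (edge⇒adjacent e))))

  side-nbr : ∀ v j → sideᵛ (nbr v j) ≡ not (sideᵛ v)
  side-nbr v j = trans (side-≡ (label-vertex _)) (side-neighbour (label v) j)

  cell-nbr : ∀ v j → cellᵛ (nbr v j) ≡ j
  cell-nbr v j = trans (cell-≡ (label-vertex _)) (cell-neighbour (label v) j)

  neighbourhood : ∀ v → Fin n ↔ Nbr Γ v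
  neighbourhood v = mk↔ₛ′ (λ j → nbr v j , nbr-edge v j) (cellᵛ ∘ proj₁) nbr-cell (cell-nbr v)
    where
    Σ-≡ : ∀ {w w′} → w ≡ w′ → (e : Edge Γ v w) (e′ : Edge Γ v w′) → (w , e) ≡ (w′ , e′)
    Σ-≡ refl e e′ = cong (_ ,_) (UIP.Decidable⇒UIP.≡-irrelevant Bool._≟_ e e′)
    nbr-cell : ∀ w → (nbr v (cellᵛ (proj₁ w)) , nbr-edge v _) ≡ w
    nbr-cell (w , e) = Σ-≡ (sym (nbr-unique e)) _ e

  one-neighbour : ∀ v → sideᵛ v ≡ false → ∀ j → ∃! _≡_ (λ w → Edge Γ v w × Yi Γ sideᵛ cellᵛ j w)
  one-neighbour v v-side j = nbr v j , (nbr-edge v j , trans (side-nbr v j) (cong not v-side) , cell-nbr v j) ,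
    λ (e , _ , w-cell) → trans (cong (nbr v) (sym w-cell)) (sym (nbr-unique e))

  Path : Label → Label → Set
  Path d e = Star (Edge Γ) (vertex d) (vertex e)

  step : ∀ d e → Adjacent d e → Path d e
  step d e a = adjacent⇒edge {vertex d} {vertex e}
    (adjacent-resp (≈ₗ-sym (label-vertex d)) (≈ₗ-sym (label-vertex e)) a) ◅ ε

  path-resp : ∀ {d d′ e e′} → d ≈ₗ d′ → e ≈ₗ e′ → Path d e → Path d′ e′
  path-resp d≈ e≈ = subst₂ (Star (Edge Γ)) (vertex-cong d≈) (vertex-cong e≈)

  origin : Matrix n' → Label
  origin a = ⟨ false , zero , a ⟩

  Reachable : Matrix n' → Set
  Reachable z = ∀ a → Path (origin a) (origin (a +ₘ z))

  reachable-resp : ∀ {z z′} → z ≈ₘ z′ → Reachable z → Reachable z′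
  reachable-resp z≈ reach a = path-resp ≈ₗ-refl (same refl refl λ k l → cong (a k l +_) (z≈ k l)) (reach a)

  reachable-0 : Reachable 0ₘ
  reachable-0 a = path-resp ≈ₗ-refl (same refl refl λ k l → sym (identityʳ (a k l))) ε

  reachable-+ : ∀ {z z′} → Reachable z → Reachable z′ → Reachable (z +ₘ z′)
  reachable-+ {z} {z′} reach reach′ a =
    reach a ◅◅ path-resp ≈ₗ-refl (same refl refl λ k l → assoc (a k l) (z k l) (z′ k l)) (reach′ (a +ₘ z))

  reachable-sum : ∀ {r} (F : Fin r → Matrix n') → (∀ k → Reachable (F k)) →
                  Reachable (λ x y → sum (λ k → F k x y))
  reachable-sum {ℕ.zero}  F reach = reachable-0
  reachable-sum {ℕ.suc r} F reach = reachable-+ (reach zero) (reachable-sum (F ∘ suc) (reach ∘ suc))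

  -- the closed walk X_0 → Y_0 → X_{k+1} → Y_{l+1} → X_0
  reachable-voltage : ∀ k l → Reachable (voltage (suc k) (suc l))
  reachable-voltage k l a =
    step (origin a) ⟨ true , zero , a ⟩ (inj₁ (link refl refl λ x y → sym (identityʳ (a x y)))) ◅◅
    step ⟨ true , zero , a ⟩ ⟨ false , suc k , a ⟩ (inj₂ (link refl refl λ x y →
      sym (trans (cong (a x y +_) (voltage-zeroʳ (suc k) x y)) (identityʳ (a x y))))) ◅◅
    step ⟨ false , suc k , a ⟩ ⟨ true , suc l , b ⟩ (inj₁ (link refl refl λ _ _ → refl)) ◅◅
    step ⟨ true , suc l , b ⟩ (origin b) (inj₂ (link refl refl λ x y → sym (identityʳ (b x y))))
    where
    b : Matrix n'
    b = a +ₘ voltage (suc k) (suc l)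

  single : Fin n' → Fin n' → Fin m → Matrix n'
  single k l v x y = δ k x (δ l y v)

  reachable-single : ∀ k l v → Reachable (single k l v)
  reachable-single k l v =
    reachable-resp (λ x y → cong (λ w → single k l w x y) (1#-generates v)) (multiples (toℕ v))
    where
    multiples : ∀ t → Reachable (single k l (t · 1#))
    multiples ℕ.zero    = reachable-resp (λ x y → sym (trans (cong (δ k x) (δ-zero l y)) (δ-zero k x))) reachable-0
    multiples (ℕ.suc t) = reachable-resp (λ x y → sym (trans (cong (δ k x) (δ-homo l y 1# (t · 1#)))
                                                             (δ-homo k x (δ l y 1#) (δ l y (t · 1#)))))
                                         (reachable-+ (reachable-voltage k l) (multiples t))

  decomposition : ∀ z → (λ x y → sum (λ k → sum (λ l → single k l (z k l) x y))) ≈ₘ z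
  decomposition z x y = begin
    sum (λ k → sum (λ l → δ k x (δ l y (z k l))))   ≡⟨ sum-cong-≗ (λ k → sym (δ-sum k x (λ l → δ l y (z k l)))) ⟩
    sum (λ k → δ k x (sum (λ l → δ l y (z k l))))   ≡⟨ sum-cong-≗ (λ k → δ-sym k x _) ⟩
    sum (λ k → δ x k (sum (λ l → δ l y (z k l))))   ≡⟨ sum-δ x _ ⟩
    sum (λ l → δ l y (z x l))                       ≡⟨ sum-cong-≗ (λ l → δ-sym l y _) ⟩
    sum (λ l → δ y l (z x l))                       ≡⟨ sum-δ y _ ⟩
    z x y                                           ∎
    where open ≡-Reasoning

  reachable : ∀ z → Reachable z
  reachable z = reachable-resp (decomposition z)
    (reachable-sum _ λ k → reachable-sum _ λ l → reachable-single k l (z k l))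

  Y-to-origin : ∀ j a → Path ⟨ true , j , a ⟩ (origin 0ₘ)
  Y-to-origin j a =
    step ⟨ true , j , a ⟩ (origin a) (inj₂ (link refl refl λ k l → sym (identityʳ (a k l)))) ◅◅
    path-resp ≈ₗ-refl (same refl refl λ k l → +-inverseʳ (a k l)) (reachable (-ₘ a) a)

  to-origin : ∀ d → Path d (origin 0ₘ)
  to-origin ⟨ false , i , a ⟩ =
    step ⟨ false , i , a ⟩ ⟨ true , zero , a ⟩ (inj₁ (link refl refl λ k l →
      sym (trans (cong (a k l +_) (voltage-zeroʳ i k l)) (identityʳ (a k l))))) ◅◅
    Y-to-origin zero a
  to-origin ⟨ true , j , a ⟩ = Y-to-origin j a

  connected : Connected Γ
  connected u v = subst₂ (Star (Edge Γ)) (vertex-label u) (vertex-label v)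
                         (to-origin (label u) ◅◅ reverse edge-sym (to-origin (label v)))

  record Symmetry : Set where
    field
      to from       : Label → Label
      to-cong       : ∀ {d e} → d ≈ₗ e → to d ≈ₗ to e
      from-cong     : ∀ {d e} → d ≈ₗ e → from d ≈ₗ from e
      from-to       : ∀ d → from (to d) ≈ₗ d
      to-from       : ∀ d → to (from d) ≈ₗ d
      to-adjacent   : ∀ {d e} → Adjacent d e → Adjacent (to d) (to e)
      from-adjacent : ∀ {d e} → Adjacent d e → Adjacent (from d) (from e)

    onVertices : Vertex → Vertex
    onVertices v = vertex (to (label v))

    label-onVertices : ∀ v → label (onVertices v) ≈ₗ to (label v)
    label-onVertices v = label-vertex (to (label v))

    automorphism : IsAutomorphism Γ onVertices
    automorphism = record
      { inverse        = λ v → vertex (from (label v))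
      ; inverseˡ       = λ v → trans (vertex-cong (≈ₗ-trans (from-cong (label-onVertices v)) (from-to (label v))))
                                     (vertex-label v)
      ; inverseʳ       = λ v → trans (vertex-cong (≈ₗ-trans (to-cong (label-vertex _)) (to-from (label v))))
                                     (vertex-label v)
      ; adj-preserving = λ u v → does-⇔ (mk⇔ (reflect u v) (preserve u v)) (adjacent? _ _) (adjacent? _ _)
      }
      where
      preserve : ∀ u v → Adjacent (label u) (label v) → Adjacent (label (onVertices u)) (label (onVertices v))
      preserve u v a = adjacent-resp (≈ₗ-sym (label-onVertices u)) (≈ₗ-sym (label-onVertices v)) (to-adjacent a)
      reflect : ∀ u v → Adjacent (label (onVertices u)) (label (onVertices v)) → Adjacent (label u) (label v)
      reflect u v a = adjacent-resp (from-to (label u)) (from-to (label v))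
                        (from-adjacent (adjacent-resp (label-onVertices u) (label-onVertices v) a))

  shift : Matrix n' → Label → Label
  shift z d = ⟨ side d , cell d , mat d +ₘ z ⟩

  shift-cong : ∀ z {d e} → d ≈ₗ e → shift z d ≈ₗ shift z e
  shift-cong z (same p q r) = same p q λ k l → cong (_+ z k l) (r k l)

  shift-adjacent : ∀ z {d e} → Adjacent d e → Adjacent (shift z d) (shift z e)
  shift-adjacent z = map⊎ shift-link shift-link
    where
    shift-link : ∀ {d e} → Link d e → Link (shift z d) (shift z e)
    shift-link {d} {e} (link X Y offset) = link X Y λ k l →
      trans (cong (_+ z k l) (offset k l)) (xy∙z≈xz∙y (mat d k l) (voltage (cell d) (cell e) k l) (z k l))

  translation : Matrix n' → Symmetry
  translation z = record
    { to            = shift z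
    ; from          = shift (-ₘ z)
    ; to-cong       = shift-cong z
    ; from-cong     = shift-cong (-ₘ z)
    ; from-to       = λ d → same refl refl λ k l → //-rightDividesʳ (z k l) (mat d k l)
    ; to-from       = λ d → same refl refl λ k l → //-rightDividesˡ (z k l) (mat d k l)
    ; to-adjacent   = shift-adjacent z
    ; from-adjacent = shift-adjacent (-ₘ z)
    }

  dual : Label → Label
  dual d = ⟨ not (side d) , cell d , (λ k l → - mat d l k) ⟩

  dual-cong : ∀ {d e} → d ≈ₗ e → dual d ≈ₗ dual e
  dual-cong (same p q r) = same (cong not p) q λ k l → cong -_ (r l k)

  dual-involutive : ∀ d → dual (dual d) ≈ₗ d
  dual-involutive d = same (not-involutive (side d)) refl λ k l → ⁻¹-involutive (mat d k l)

  dual-link : ∀ {d e} → Link d e → Link (dual e) (dual d)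
  dual-link {d} {e} (link X Y offset) = link (cong not Y) (cong not X) λ k l → begin
    - mat d l k                      ≡⟨ //-rightDividesˡ (v l k) (- mat d l k) ⟨
    - mat d l k + - v l k + v l k    ≡⟨ cong₂ _+_ (⁻¹-∙-comm (mat d l k) (v l k)) (voltage-transpose (cell d) (cell e) l k) ⟩
    - (mat d l k + v l k) + vᵀ k l   ≡⟨ cong (λ x → - x + vᵀ k l) (offset l k) ⟨
    - mat e l k + vᵀ k l             ∎
    where
    open ≡-Reasoning
    v vᵀ : Matrix n'
    v  = voltage (cell d) (cell e)
    vᵀ = voltage (cell e) (cell d)

  dual-adjacent : ∀ {d e} → Adjacent d e → Adjacent (dual d) (dual e)
  dual-adjacent (inj₁ de) = inj₂ (dual-link de)
  dual-adjacent (inj₂ ed) = inj₁ (dual-link ed)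

  duality : Symmetry
  duality = record
    { to            = dual
    ; from          = dual
    ; to-cong       = dual-cong
    ; from-cong     = dual-cong
    ; from-to       = dual-involutive
    ; to-from       = dual-involutive
    ; to-adjacent   = dual-adjacent
    ; from-adjacent = dual-adjacent
    }

  columnSums : Bool → Fin n → Fin n' → Fin m
  columnSums false _ _ = 0#
  columnSums true  j   = unitRow j

  full : Label → Matrix n
  full d = extend (columnSums (side d) (cell d)) (mat d)

  colsum-full : ∀ d l → colsum (full d) l ≡ columnSums (side d) (cell d) l
  colsum-full d = colsum-extend (columnSums (side d) (cell d)) (mat d)

  full-cong : ∀ {d e} → d ≈ₗ e → full d ≈ₘ full e
  full-cong (same p q r) zero    l = cong₂ (λ t s → t + - s) (cong₂ (λ s i → columnSums s i l) p q)
                                          (sum-cong-≗ (λ k → r k l))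
  full-cong (same p q r) (suc k) l = r k l

  full-link : ∀ {d e} → Link d e → full e ≈ₘ full d +ₘ elementary (cell d) (cell e)
  full-link {d} {e} (link X Y offset) = extend-unique (full d +ₘ E) sums (λ k l → sym (offset k l))
    where
    open ≡-Reasoning
    E = elementary (cell d) (cell e)
    sums : ∀ l → colsum (full d +ₘ E) l ≡ columnSums (side e) (cell e) l
    sums l = begin
      colsum (full d +ₘ E) l                               ≡⟨ ∑-distrib-+ (λ r → full d r l) (λ r → E r l) ⟩
      colsum (full d) l + colsum E l                       ≡⟨ cong₂ _+_ (colsum-full d l) colsum-E ⟩
      columnSums (side d) (cell d) l + unitRow (cell e) l  ≡⟨ cong (λ s → columnSums s (cell d) l + _) X ⟩
      0# + unitRow (cell e) l                              ≡⟨ identityˡ _ ⟩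
      unitRow (cell e) l                                   ≡⟨ cong (λ s → columnSums s (cell e) l) Y ⟨
      columnSums (side e) (cell e) l                       ∎
      where
      colsum-E : colsum E l ≡ unitRow (cell e) l
      colsum-E = colsum-elementary (cell d) (cell e) l

  onX : (Fin n → Fin n) → Bool → Fin n → Fin n
  onX σ s = if s then id else σ

  permuteX : Permutation′ n → Label → Label
  permuteX π d = ⟨ side d , onX (π ⟨$⟩ʳ_) (side d) (cell d) , restrict (λ r → full d (π ⟨$⟩ˡ r)) ⟩

  full-permuteX : ∀ π d → full (permuteX π d) ≈ₘ (λ r → full d (π ⟨$⟩ˡ r))
  full-permuteX π d = extend-unique (λ r → full d (π ⟨$⟩ˡ r))
    (λ l → trans (colsum-permute π (full d) l) (trans (colsum-full d l) (columnSums-onX (side d) l)))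
    (λ _ _ → refl)
    where
    columnSums-onX : ∀ s → columnSums s (cell d) ≗ columnSums s (onX (π ⟨$⟩ʳ_) s (cell d))
    columnSums-onX false _ = refl
    columnSums-onX true  _ = refl

  permuteX-cong : ∀ π {d e} → d ≈ₗ e → permuteX π d ≈ₗ permuteX π e
  permuteX-cong π d≈e@(same p q r) =
    same p (cong₂ (onX (π ⟨$⟩ʳ_)) p q) λ k l → full-cong d≈e (π ⟨$⟩ˡ suc k) l

  permuteX-inverse : ∀ π d → permuteX (Perm.flip π) (permuteX π d) ≈ₗ d
  permuteX-inverse π d = same refl (cell-inverse (side d)) λ k l →
    trans (full-permuteX π d (π ⟨$⟩ʳ suc k) l) (cong (λ r → full d r l) (Perm.inverseˡ π))
    where
    cell-inverse : ∀ s → onX (π ⟨$⟩ˡ_) s (onX (π ⟨$⟩ʳ_) s (cell d)) ≡ cell d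
    cell-inverse false = Perm.inverseˡ π
    cell-inverse true  = refl

  permuteX-adjacent : ∀ π {d e} → Adjacent d e → Adjacent (permuteX π d) (permuteX π e)
  permuteX-adjacent π = map⊎ permuteX-link permuteX-link
    where
    permuteX-link : ∀ {d e} → Link d e → Link (permuteX π d) (permuteX π e)
    permuteX-link {d} {e} de@(link X Y offset) = link X Y offset′
      where
      open ≡-Reasoning
      σ : Bool → Fin n → Fin n
      σ = onX (π ⟨$⟩ʳ_)
      offset′ : ∀ k l → full e (π ⟨$⟩ˡ suc k) l ≡
                        full d (π ⟨$⟩ˡ suc k) l + voltage (σ (side d) (cell d)) (σ (side e) (cell e)) k l
      offset′ k l = begin
        full e r l                                                            ≡⟨ full-link de r l ⟩
        full d r l + elementary (cell d) (cell e) r l                         ≡⟨ cong (full d r l +_) (δ-permute π _ _ _) ⟩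
        full d r l + voltage (π ⟨$⟩ʳ cell d) (cell e) k l                     ≡⟨ cong₂ moved X Y ⟨
        full d r l + voltage (σ (side d) (cell d)) (σ (side e) (cell e)) k l  ∎
        where
        r : Fin n
        r = π ⟨$⟩ˡ suc k
        moved : Bool → Bool → Fin m
        moved s t = full d r l + voltage (σ s (cell d)) (σ t (cell e)) k l

  permutationOfX : Permutation′ n → Symmetry
  permutationOfX π = record
    { to            = permuteX π
    ; from          = permuteX (Perm.flip π)
    ; to-cong       = permuteX-cong π
    ; from-cong     = permuteX-cong (Perm.flip π)
    ; from-to       = permuteX-inverse π
    ; to-from       = permuteX-inverse (Perm.flip π)
    ; to-adjacent   = permuteX-adjacent π
    ; from-adjacent = permuteX-adjacent (Perm.flip π)
    }

  module WithL (L : PermGroup n) where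

    open PartPreserving Γ sideᵛ cellᵛ L public
    open Member

    fromSymmetry : (S : Symmetry) (b : Bool) (ρ : Bool → Fin n → Fin n) → (∀ s → Mem L (ρ s)) →
      (∀ d → side (Symmetry.to S d) ≡ side d xor b × cell (Symmetry.to S d) ≡ ρ (side d) (cell d)) →
      Member (Symmetry.onVertices S)
    fromSymmetry S b ρ ρ∈L maps = record
      { automorphism = Symmetry.automorphism S
      ; flip         = b
      ; ρ            = ρ
      ; ρ∈L          = ρ∈L
      ; maps-parts   = λ v → trans (side-≡ (Symmetry.label-onVertices S v)) (proj₁ (maps (label v))) ,
                             trans (cell-≡ (Symmetry.label-onVertices S v)) (proj₂ (maps (label v)))
      }

    translate : Matrix n' → Vertex → Vertex
    translate z = Symmetry.onVertices (translation z)

    translate∈G : ∀ z → Member (translate z)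
    translate∈G z = fromSymmetry (translation z) false (λ _ → id) (λ _ → id∈ L) λ d →
      sym (xor-identityʳ (side d)) , refl

    translate-onto : ∀ {u v} → sideᵛ u ≡ sideᵛ v → cellᵛ u ≡ cellᵛ v → translate (matᵛ v +ₘ -ₘ matᵛ u) u ≡ v
    translate-onto {u} {v} p q = trans (vertex-cong (same p q λ k l → begin
      matᵛ u k l + (matᵛ v k l + - matᵛ u k l)   ≡⟨ +-comm (matᵛ u k l) _ ⟩
      matᵛ v k l + - matᵛ u k l + matᵛ u k l     ≡⟨ //-rightDividesˡ (matᵛ u k l) (matᵛ v k l) ⟩
      matᵛ v k l                                 ∎)) (vertex-label v)
      where open ≡-Reasoning

    f : Vertex → Vertex
    f = Symmetry.onVertices duality

    f∈G : Member f
    f∈G = fromSymmetry duality true (λ _ → id) (λ _ → id∈ L) λ d →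
      sym (trans (xor-comm (side d) true) (true-xor (side d))) , refl

    f-involutive : f ∘ f ≗ id
    f-involutive v =
      trans (vertex-cong (≈ₗ-trans (dual-cong (label-vertex _)) (dual-involutive (label v)))) (vertex-label v)

    open Swapping f∈G refl f-involutive public

    asPermutation : ∀ {σ} → Mem L σ → Permutation′ n
    asPermutation {σ} σ∈L = let σ⁻¹ , _ , σ⁻¹σ , σσ⁻¹ = inv∈ L σ∈L in Perm.permutation σ σ⁻¹ σσ⁻¹ σ⁻¹σ

    moveX : ∀ {σ} → Mem L σ → Vertex → Vertex
    moveX σ∈L = Symmetry.onVertices (permutationOfX (asPermutation σ∈L))

    moveX∈G : ∀ {σ} (σ∈L : Mem L σ) → Member (moveX σ∈L)
    moveX∈G {σ} σ∈L = fromSymmetry (permutationOfX (asPermutation σ∈L)) false (onX σ) onX∈L λ d →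
      sym (xor-identityʳ (side d)) , refl
      where
      onX∈L : ∀ s → Mem L (onX σ s)
      onX∈L false = σ∈L
      onX∈L true  = id∈ L

    moveY : ∀ {τ} → Mem L τ → Vertex → Vertex
    moveY τ∈L = f ∘ moveX τ∈L ∘ f

    moveY∈G : ∀ {τ} (τ∈L : Mem L τ) → Member (moveY τ∈L)
    moveY∈G τ∈L = member-∘ f∈G (member-∘ (moveX∈G τ∈L) f∈G)

    X-transitive : IsTransitive L → ∀ u v → sideᵛ u ≡ false → sideᵛ v ≡ false → ∃[ g ] (Member g × g u ≡ v)
    X-transitive L-transitive u v u-side v-side =
      let σ , σ∈L , σu≡v = L-transitive (cellᵛ u) (cellᵛ v)
          w-side = trans (side-map (moveX∈G σ∈L) u) (trans (xor-identityʳ _) (trans u-side (sym v-side)))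
          w-cell = trans (cell-map (moveX∈G σ∈L) u) (trans (cong (λ s → onX σ s (cellᵛ u)) u-side) σu≡v)
      in  _ , member-∘ (translate∈G _) (moveX∈G σ∈L) , translate-onto w-side w-cell

    pin : (Vertex → Vertex) → Vertex → Vertex → Vertex
    pin h v = translate (matᵛ v +ₘ -ₘ matᵛ (h v)) ∘ h

    pin∈G : ∀ {h} → Member h → ∀ v → Member (pin h v)
    pin∈G H v = member-∘ (translate∈G _) H

    pin-fixes : ∀ {h s} (H : Member h) v → flip H ≡ false → sideᵛ v ≡ s → ρ H s ≗ id → pin h v v ≡ v
    pin-fixes H v unflipped refl ρ≗id = translate-onto (proj₂ (kernel H unflipped) v) (trans (cell-map H v) (ρ≗id _))

    fixer-on-neighbours : ∀ {g v} (G : Member g) → g v ≡ v → ∀ i → g (nbr v i) ≡ nbr v (ρ G (not (sideᵛ v)) i)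
    fixer-on-neighbours {g} {v} G g-fixes i = begin
      g (nbr v i)                                       ≡⟨ nbr-unique edge ⟩
      nbr v (cellᵛ (g (nbr v i)))                       ≡⟨ cong (nbr v) (cell-map G (nbr v i)) ⟩
      nbr v (ρ G (sideᵛ (nbr v i)) (cellᵛ (nbr v i)))   ≡⟨ cong₂ (λ s j → nbr v (ρ G s j)) (side-nbr v i) (cell-nbr v i) ⟩
      nbr v (ρ G (not (sideᵛ v)) i)                     ∎
      where
      open ≡-Reasoning
      edge : Edge Γ v (g (nbr v i))
      edge = subst (λ u → Edge Γ u (g (nbr v i))) g-fixes (trans (adj-preserving G v (nbr v i)) (nbr-edge v i))

    pinned-on-neighbours : ∀ {h s π} (H : Member h) v → flip H ≡ false → sideᵛ v ≡ s →
                           ρ H s ≗ id → ρ H (not s) ≗ π →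
                           ∃[ g ] (Member g × g v ≡ v × ∀ i → g (nbr v i) ≡ nbr v (π i))
    pinned-on-neighbours H v unflipped refl ρ≗id ρ≗π = pin _ v , pin∈G H v , fixes ,
      λ i → trans (fixer-on-neighbours (pin∈G H v) fixes i) (cong (nbr v) (ρ≗π i))
      where fixes = pin-fixes H v unflipped refl ρ≗id

    local-action : ∀ v → LocalPermIso Γ partGroup v L
    local-action v = neighbourhood v ,
                     (λ g G g-fixes → ρ G (not (sideᵛ v)) , ρ∈L G _ , fixer-on-neighbours G g-fixes) ,
                     λ π π∈L → swap π∈L (sideᵛ v) refl
      where
      swap : ∀ {π} → Mem L π → ∀ s → sideᵛ v ≡ s →
             ∃[ g ] (Member g × g v ≡ v × ∀ i → g (nbr v i) ≡ nbr v (π i))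
      swap π∈L false v-side = pinned-on-neighbours (moveY∈G π∈L) v refl v-side (λ _ → refl) (λ _ → refl)
      swap π∈L true  v-side = pinned-on-neighbours (moveX∈G π∈L) v refl v-side (λ _ → refl) (λ _ → refl)

    local-swap : ∀ v → sideᵛ v ≡ false → ∀ π → Mem L π →
                 ∃[ s ] (S s × s v ≡ v ×
                         (∀ i → ImageEq s (Xi Γ sideᵛ cellᵛ i) (Xi Γ sideᵛ cellᵛ i)) ×
                         (∀ i → ImageEq s (Yi Γ sideᵛ cellᵛ i) (Yi Γ sideᵛ cellᵛ (π i))))
    local-swap v v-side π π∈L = pin (moveY π∈L) v , kernel swap refl ,
      pin-fixes (moveY∈G π∈L) v refl v-side (λ _ → refl) , image-part swap false , image-part swap true
      where swap = pin∈G (moveY∈G π∈L) v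

    kernel→L×L : ∀ s → S s → ∃[ σ ] ∃[ τ ] (Mem L σ × Mem L τ × ActsBy s σ τ)
    kernel→L×L s (K , s-side) =
      ρ K false , ρ K true , ρ∈L K false , ρ∈L K true , acts-by K s-side (λ _ → refl) (λ _ → refl)

    L×L→kernel : ∀ σ τ → Mem L σ → Mem L τ → ∃[ s ] (S s × ActsBy s σ τ)
    L×L→kernel σ τ σ∈L τ∈L = _ , kernel XY refl , acts-by XY (proj₂ (kernel XY refl)) (λ _ → refl) (λ _ → refl)
      where XY = member-∘ (moveX∈G σ∈L) (moveY∈G τ∈L)

lemma2p1 : (n : ℕ) → 2 ≤ n → (L : PermGroup n) → IsTransitive L →
           (N₀ : ℕ) → Lemma2p1Pair n L N₀
lemma2p1 (ℕ.suc (ℕ.suc k)) (ℕ.s≤s (ℕ.s≤s ℕ.z≤n)) L L-transitive N₀ = record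
  { Γ              = Γ
  ; G              = partGroup
  ; G≤Aut          = λ g G → Member.adj-preserving G
  ; large          = m≤order zero
  ; connected      = connected
  ; valent         = λ v → ↔-sym (neighbourhood v)
  ; side           = sideᵛ
  ; bipartite      = bipartite
  ; locally        = connected , vertex-transitive (X-transitive L-transitive) , local-action
  ; cell           = cellᵛ
  ; parts-nonempty = parts-nonempty
  ; G-invariant    = λ g → preserves-partition
  ; one-neighbour  = one-neighbour
  ; f              = f
  ; f∈G            = f∈G
  ; f²=1           = f-involutive
  ; fX             = image-part f∈G false
  ; fY             = image-part f∈G true
  ; G=⟨S,f⟩        = λ g → mk⇔ generated generated⇒member
  ; Sᶠ=S           = kernel-conjugate
  ; ψ              = ψ
  ; S→L×L          = kernel→L×L
  ; L×L→S          = L×L→kernel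
  ; local-swap     = local-swap
  }
  where
  open Cover (ℕ.suc k) (ℕ.suc N₀)
  open WithL L
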